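{- Let $q$ be a prime power and $V_3$ a $3$-dimensional vector space over $\mathbb{F}_q$. Let $k,l$ be positive integers with $k,l\le q-\frac{\sqrt{2}}{2}q$, and let $\mathcal{F}$ be a family consisting of $1$- and $2$-dimensional subspaces of $V_3$ that contains neither $\mathrm{V}_k$ nor $\Lambda_l$ as a subposet. Then $|\mathcal{F}|\le q^2+q+1$, and equality holds only if $\mathcal{F}$ is the set of all $1$-dimensional subspaces of $V_3$ or the set of all $2$-dimensional subspaces of $V_3$.
   Context: Subspaces are ordered by inclusion; a subposet is given by an injection $\phi$ with $x\le y\Rightarrow\phi(x)\subseteq\phi(y)$. $\mathrm{V}_k$ is the poset with elements $x_1,\dots,x_k,y$ where $x_1,\dots,x_k>y$ (no other relations), and $\Lambda_l$ the poset with elements $x_1,\dots,x_l,y$ where $x_1,\dots,x_l<y$. -}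

module Defs where

open import Level using (0ℓ)
open import Algebra.Bundles using (CommutativeRing)
open import Data.Nat as ℕ using (ℕ)
open import Data.Fin using (Fin; zero; suc)
open import Data.Product using (Σ; ∃; ∃₂; _×_; _,_)
open import Data.Sum using (_⊎_)
open import Data.List using (List; length; lookup)
open import Relation.Nullary using (¬_)
open import Relation.Binary.Definitions using (Decidable)
open import Relation.Binary.PropositionalEquality using (_≡_)

-- A finite field with exactly q elements.  (Its order q is then
-- necessarily a prime power, and every prime power occurs.)
record FiniteField (q : ℕ) : Set₁ where
  field
    cring : CommutativeRing 0ℓ 0ℓ
  open CommutativeRing cring public
  field
    0≉1      : ¬ (0# ≈ 1#)
    inverse  : ∀ x → ¬ (x ≈ 0#) → ∃ λ y → (x * y) ≈ 1#
    _≟_      : Decidable _≈_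
    enum     : Fin q → Carrier
    enum-inj : ∀ i j → enum i ≈ enum j → i ≡ j
    enum-sur : ∀ x → ∃ λ i → enum i ≈ x

module Geometry {q : ℕ} (𝔽 : FiniteField q) where
  open FiniteField 𝔽 using (Carrier; _≈_; _+_; _*_; 0#)

  V : Set
  V = Fin 3 → Carrier

  IsZero : V → Set
  IsZero v = ∀ i → v i ≈ 0#

  Independent : V → V → Set
  Independent u w = ∀ a b → IsZero (λ i → (a * u i) + (b * w i)) → (a ≈ 0#) × (b ≈ 0#)

  data Sub : Set where
    line  : (v : V) → ¬ IsZero v → Sub
    plane : (u w : V) → Independent u w → Sub

  dim : Sub → ℕ
  dim (line _ _)    = 1
  dim (plane _ _ _) = 2

  _∈_ : V → Sub → Set
  x ∈ line v _    = ∃ λ a → ∀ i → x i ≈ (a * v i)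
  x ∈ plane u w _ = ∃₂ λ a b → ∀ i → x i ≈ ((a * u i) + (b * w i))

  _⊆_ : Sub → Sub → Set
  A ⊆ B = ∀ x → x ∈ A → x ∈ B

  _≐_ : Sub → Sub → Set
  A ≐ B = (A ⊆ B) × (B ⊆ A)

  -- a family of subspaces: a list without repetitions (up to ≐)
  Family : Set
  Family = List Sub

  NoDup : Family → Set
  NoDup ℱ = ∀ i j → lookup ℱ i ≐ lookup ℱ j → i ≡ j

  -- ℱ contains V_k as a subposet: injection φ of {y, x₁..x_k}
  -- (y = zero, x_i = suc i) into ℱ with φ(y) ⊆ φ(x_i).
  ContainsV : ℕ → Family → Set
  ContainsV k ℱ = Σ (Fin (ℕ.suc k) → Fin (length ℱ)) λ φ →
    (∀ i j → φ i ≡ φ j → i ≡ j) ×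
    (∀ i → lookup ℱ (φ zero) ⊆ lookup ℱ (φ (suc i)))

  -- ℱ contains Λ_l as a subposet: φ(x_i) ⊆ φ(y).
  ContainsΛ : ℕ → Family → Set
  ContainsΛ l ℱ = Σ (Fin (ℕ.suc l) → Fin (length ℱ)) λ φ →
    (∀ i j → φ i ≡ φ j → i ≡ j) ×
    (∀ i → lookup ℱ (φ (suc i)) ⊆ lookup ℱ (φ zero))

  AllOfDim : ℕ → Family → Set
  AllOfDim d ℱ = (∀ i → dim (lookup ℱ i) ≡ d) ×
                 (∀ S → dim S ≡ d → ∃ λ i → lookup ℱ i ≐ S)

-- k ≤ q - (√2/2) q, for natural numbers k, q:
-- equivalent to  k ≤ q  and  q² ≤ 2 (q - k)².
BoundOK : ℕ → ℕ → Set
BoundOK q k = (k ℕ.≤ q) × ((q ℕ.* q) ℕ.≤ 2 ℕ.* ((q ℕ.∸ k) ℕ.* (q ℕ.∸ k)))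

module Submission where

-- Lines and planes of V₃ are the points and lines of the projective plane of
-- order q, which has N = q² + q + 1 of each, and inclusion is incidence.  Let ℱ
-- consist of P lines and L planes.  A plane of ℱ contains fewer than l lines of
-- ℱ (no Λ_l), so at least q + 2 − l of its q + 1 points lie outside ℱ; since
-- two points lie on at most one common line, the ordered pairs of such points
-- taken on the different planes of ℱ are distinct, whence L (q+2−l)(q+1−l) ≤ x²
-- for the number x of points outside ℱ, while x + P ≤ N; dually for the number
-- y of lines outside ℱ.
-- If P, L ≥ 1 and P + L ≥ N this gives x ≥ (q+2−l)(q+1−l), y ≥ (q+2−k)(q+1−k)
-- and x + y ≤ N, which k, l ≤ q − (√2/2) q makes impossible.  Hence P + L ≤ N,
-- and at equality one kind is absent and the other complete.

open import Level using (0ℓ)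
open import Algebra.Bundles using (CommutativeRing)
open import Data.Nat using (ℕ)
open import Defs

-- Every commutative ring receives the canonical homomorphism from ℤ, so the
-- ring solver can be run over it with integer coefficients.
module IntegerCoefficientSolver (R : CommutativeRing 0ℓ 0ℓ) where

  open import Algebra.Solver.Ring.AlmostCommutativeRing
    using (fromCommutativeRing; _-Raw-AlmostCommutative⟶_)
  open import Data.Nat as ℕ using (ℕ; zero; suc)
  import Data.Nat.Properties as ℕ
  open import Data.Integer as ℤ using (ℤ; +_; -[1+_]; _⊖_; _◃_; sign; ∣_∣)
  import Data.Integer.Properties as ℤ
  open import Data.Sign as Sign using (Sign)
  open import Data.Maybe using (Maybe; just; nothing)
  open import Relation.Nullary using (yes; no)
  open import Relation.Binary.PropositionalEquality as ≡ using (_≡_)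

  open CommutativeRing R
  open import Relation.Binary.Reasoning.Setoid setoid
  open import Algebra.Properties.Ring ring using (-1*x≈-x)
  open import Algebra.Properties.AbelianGroup +-abelianGroup using (⁻¹-∙-comm)
  open import Algebra.Properties.Group +-group using (⁻¹-involutive; ε⁻¹≈ε)
  open import Algebra.Properties.Semiring.Mult.TCOptimised semiring
    using (_×_; 1+×; ×-homo-+; ×1-homo-*)

  fromℤ : ℤ → Carrier
  fromℤ (+ n)    = n × 1#
  fromℤ -[1+ n ] = - (suc n × 1#)

  private
    shift-difference : ∀ a b c → (a + b) - (a + c) ≈ b - c
    shift-difference a b c = begin
      (a + b) + - (a + c)     ≈⟨ +-congˡ (sym (⁻¹-∙-comm a c)) ⟩
      (a + b) + (- a + - c)   ≈⟨ sym (+-assoc _ _ _) ⟩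
      ((a + b) + - a) + - c   ≈⟨ +-congʳ (+-congʳ (+-comm a b)) ⟩
      ((b + a) + - a) + - c   ≈⟨ +-congʳ (+-assoc b a (- a)) ⟩
      (b + (a + - a)) + - c   ≈⟨ +-congʳ (+-congˡ (-‿inverseʳ a)) ⟩
      (b + 0#) + - c          ≈⟨ +-congʳ (+-identityʳ b) ⟩
      b + - c                 ∎

  fromℤ-⊖ : ∀ m n → fromℤ (m ⊖ n) ≈ m × 1# - n × 1#
  fromℤ-⊖ m zero = begin
    m × 1#          ≈⟨ sym (+-identityʳ _) ⟩
    m × 1# + 0#     ≈⟨ +-congˡ (sym ε⁻¹≈ε) ⟩
    m × 1# + - 0#   ∎
  fromℤ-⊖ zero (suc n) = sym (+-identityˡ _)
  fromℤ-⊖ (suc m) (suc n) = begin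
    fromℤ (suc m ⊖ suc n)                   ≡⟨ ≡.cong fromℤ (ℤ.[1+m]⊖[1+n]≡m⊖n m n) ⟩
    fromℤ (m ⊖ n)                           ≈⟨ fromℤ-⊖ m n ⟩
    m × 1# - n × 1#                     ≈⟨ shift-difference 1# _ _ ⟨
    (1# + m × 1#) - (1# + n × 1#)       ≈⟨ +-cong (1+× m 1#) (-‿cong (1+× n 1#)) ⟨
    suc m × 1# - suc n × 1#             ∎

  fromℤ-+ : ∀ i j → fromℤ (i ℤ.+ j) ≈ fromℤ i + fromℤ j
  fromℤ-+ (+ m)    (+ n)    = ×-homo-+ 1# m n
  fromℤ-+ (+ m)    -[1+ n ] = fromℤ-⊖ m (suc n)
  fromℤ-+ -[1+ m ] (+ n)    = trans (fromℤ-⊖ n (suc m)) (+-comm _ _)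
  fromℤ-+ -[1+ m ] -[1+ n ] = begin
    - (suc (suc (m ℕ.+ n)) × 1#)          ≡⟨ ≡.cong (λ k → - (suc k × 1#)) (ℕ.+-suc m n) ⟨
    - ((suc m ℕ.+ suc n) × 1#)            ≈⟨ -‿cong (×-homo-+ 1# (suc m) (suc n)) ⟩
    - (suc m × 1# + suc n × 1#)           ≈⟨ ⁻¹-∙-comm _ _ ⟨
    - (suc m × 1#) + - (suc n × 1#)       ∎

  fromℤ-neg : ∀ i → fromℤ (ℤ.- i) ≈ - fromℤ i
  fromℤ-neg (+ zero)  = sym ε⁻¹≈ε
  fromℤ-neg (+ suc n) = refl
  fromℤ-neg -[1+ n ]  = sym (⁻¹-involutive _)

  fromSign : Sign → Carrier
  fromSign Sign.+ = 1#
  fromSign Sign.- = - 1#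

  fromℤ-◃ : ∀ s n → fromℤ (s ◃ n) ≈ fromSign s * (n × 1#)
  fromℤ-◃ s       zero    = sym (zeroʳ _)
  fromℤ-◃ Sign.+ (suc n) = sym (*-identityˡ _)
  fromℤ-◃ Sign.- (suc n) = sym (-1*x≈-x _)

  fromSign-* : ∀ s t → fromSign (s Sign.* t) ≈ fromSign s * fromSign t
  fromSign-* Sign.+ t      = sym (*-identityˡ _)
  fromSign-* Sign.- Sign.+ = sym (*-identityʳ _)
  fromSign-* Sign.- Sign.- = sym (trans (-1*x≈-x _) (⁻¹-involutive _))

  fromℤ-* : ∀ i j → fromℤ (i ℤ.* j) ≈ fromℤ i * fromℤ j
  fromℤ-* i j = begin
    fromℤ (sign i Sign.* sign j ◃ ∣ i ∣ ℕ.* ∣ j ∣)                 ≈⟨ fromℤ-◃ (sign i Sign.* sign j) (∣ i ∣ ℕ.* ∣ j ∣) ⟩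
    fromSign (sign i Sign.* sign j) * ((∣ i ∣ ℕ.* ∣ j ∣) × 1#)       ≈⟨ *-cong (fromSign-* (sign i) (sign j)) (×1-homo-* ∣ i ∣ ∣ j ∣) ⟩
    (fromSign (sign i) * fromSign (sign j)) * ((∣ i ∣ × 1#) * (∣ j ∣ × 1#)) ≈⟨ interchange _ _ _ _ ⟩
    (fromSign (sign i) * (∣ i ∣ × 1#)) * (fromSign (sign j) * (∣ j ∣ × 1#)) ≈⟨ *-cong (fromℤ-sign◃abs i) (fromℤ-sign◃abs j) ⟨
    fromℤ i * fromℤ j                                              ∎
    where
    fromℤ-sign◃abs : ∀ i → fromℤ i ≈ fromSign (sign i) * (∣ i ∣ × 1#)
    fromℤ-sign◃abs i = trans (reflexive (≡.cong fromℤ (≡.sym (ℤ.◃-inverse i)))) (fromℤ-◃ (sign i) ∣ i ∣)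
    interchange : ∀ a b c d → (a * b) * (c * d) ≈ (a * c) * (b * d)
    interchange a b c d = begin
      (a * b) * (c * d)   ≈⟨ *-assoc a b (c * d) ⟩
      a * (b * (c * d))   ≈⟨ *-congˡ (*-assoc b c d) ⟨
      a * ((b * c) * d)   ≈⟨ *-congˡ (*-congʳ (*-comm b c)) ⟩
      a * ((c * b) * d)   ≈⟨ *-congˡ (*-assoc c b d) ⟩
      a * (c * (b * d))   ≈⟨ *-assoc a c (b * d) ⟨
      (a * c) * (b * d)   ∎

  ℤ⟶R : ℤ.+-*-rawRing -Raw-AlmostCommutative⟶ fromCommutativeRing R
  ℤ⟶R = record
    { ⟦_⟧ = fromℤ ; +-homo = fromℤ-+ ; *-homo = fromℤ-* ; -‿homo = fromℤ-neg
    ; 0-homo = refl ; 1-homo = refl }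

  equal? : ∀ i j → Maybe (fromℤ i ≈ fromℤ j)
  equal? i j with i ℤ.≟ j
  ... | yes ≡.refl = just refl
  ... | no _       = nothing

  open import Algebra.Solver.Ring ℤ.+-*-rawRing (fromCommutativeRing R) ℤ⟶R equal? public

module Arithmetic where

  open import Data.Nat
  open import Data.Nat.Properties
  open import Data.Nat.Tactic.RingSolver using (solve-∀)
  open import Data.Empty using (⊥-elim)
  open import Data.Product using (_×_; _,_)
  open import Data.Sum using (_⊎_; inj₁; inj₂)
  open import Relation.Nullary using (¬_)
  open import Relation.Binary.PropositionalEquality
  open ≤-Reasoning

  -- number of ordered pairs of distinct elements of a (2 + s)-element set
  pairs : ℕ → ℕ
  pairs s = (2 + s) * (1 + s)

  square≤2*square⇒≤2* : ∀ q s → q * q ≤ 2 * (s * s) → q ≤ 2 * s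
  square≤2*square⇒≤2* q s q²≤2s² = ≮⇒≥ λ 2s<q → <⇒≱ (*-mono-< 2s<q 2s<q) (begin
    q * q                          ≤⟨ q²≤2s² ⟩
    2 * (s * s)                    ≤⟨ m≤m+n (2 * (s * s)) (2 * (s * s)) ⟩
    2 * (s * s) + 2 * (s * s)      ≡⟨ expand s ⟩
    (2 * s) * (2 * s)              ∎)
    where
    expand : ∀ s → 2 * (s * s) + 2 * (s * s) ≡ (2 * s) * (2 * s)
    expand = solve-∀

  -- For s = q ∸ k this is where the hypothesis k ≤ q - (√2/2) q enters.
  pairs-exceed : ∀ q s t → q * q ≤ 2 * (s * s) → q * q ≤ 2 * (t * t) →
                 q * q + q + 1 < pairs s + pairs t
  pairs-exceed q s t q²≤2s² q²≤2t² = *-cancelˡ-< 2 _ _ (begin-strict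
    2 * (q * q + q + 1)                                    <⟨ m<m+n _ (s≤s z≤n) ⟩
    2 * (q * q + q + 1) + suc (4 * q + 5)                  ≡⟨ regroupˡ q ⟩
    (q * q + q * q) + 3 * (q + q) + 8                      ≤⟨ +-monoˡ-≤ 8 (+-mono-≤ (+-mono-≤ q²≤2s² q²≤2t²)
                                                               (*-monoʳ-≤ 3 (+-mono-≤ (square≤2*square⇒≤2* q s q²≤2s²)
                                                                                      (square≤2*square⇒≤2* q t q²≤2t²)))) ⟩
    (2 * (s * s) + 2 * (t * t)) + 3 * (2 * s + 2 * t) + 8  ≡⟨ regroupʳ s t ⟩
    2 * (pairs s + pairs t)                                ∎)
    where
    regroupˡ : ∀ q → 2 * (q * q + q + 1) + suc (4 * q + 5) ≡ (q * q + q * q) + 3 * (q + q) + 8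
    regroupˡ = solve-∀
    regroupʳ : ∀ s t → (2 * (s * s) + 2 * (t * t)) + 3 * (2 * s + 2 * t) + 8 ≡ 2 * ((2 + s) * (1 + s) + (2 + t) * (1 + t))
    regroupʳ = solve-∀

  complement-lower-bound : ∀ q l c c′ → c′ + c ≡ suc q → c′ < l → l ≤ q → 2 + (q ∸ l) ≤ c
  complement-lower-bound q l c c′ c′+c≡1+q c′<l l≤q = +-cancelˡ-≤ c′ _ _ (begin
    c′ + (2 + (q ∸ l))        ≡⟨ rearrange c′ (q ∸ l) ⟩
    suc c′ + suc (q ∸ l)      ≤⟨ +-monoˡ-≤ _ c′<l ⟩
    l + suc (q ∸ l)           ≡⟨ +-suc l (q ∸ l) ⟩
    suc (l + (q ∸ l))         ≡⟨ cong suc (m+[n∸m]≡n l≤q) ⟩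
    suc q                     ≡⟨ c′+c≡1+q ⟨
    c′ + c                    ∎)
    where
    rearrange : ∀ c′ r → c′ + (2 + r) ≡ suc c′ + suc r
    rearrange = solve-∀

  pairs≤-of-square-bound : ∀ {M x L} → L * M ≤ x * x → x ≤ L → 1 ≤ L → M ≤ x
  pairs≤-of-square-bound {M} {x} {L@(suc _)} LM≤x² x≤L _ = *-cancelˡ-≤ L (≤-trans LM≤x² (*-monoˡ-≤ x x≤L))

  both-sides-large⇒⊥ : ∀ q {s t x y P L} → q * q ≤ 2 * (s * s) → q * q ≤ 2 * (t * t) →
                       x + P ≤ q * q + q + 1 → L * pairs s ≤ x * x →
                       y + L ≤ q * q + q + 1 → P * pairs t ≤ y * y →
                       1 ≤ P → 1 ≤ L → ¬ (q * q + q + 1 ≤ P + L)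
  both-sides-large⇒⊥ q {s} {t} {x} {y} {P} {L} q²≤2s² q²≤2t² x+P≤N Lpairs≤x² y+L≤N Ppairs≤y² 1≤P 1≤L N≤P+L =
    <⇒≱ (pairs-exceed q s t q²≤2s² q²≤2t²) (begin
      pairs s + pairs t   ≤⟨ +-mono-≤ (pairs≤-of-square-bound Lpairs≤x² x≤L 1≤L) (pairs≤-of-square-bound Ppairs≤y² y≤P 1≤P) ⟩
      x + y               ≤⟨ x+y≤N ⟩
      N                   ∎)
    where
    N = q * q + q + 1
    x≤L : x ≤ L
    x≤L = +-cancelʳ-≤ P x L (≤-trans x+P≤N (≤-trans N≤P+L (≤-reflexive (+-comm P L))))
    y≤P : y ≤ P
    y≤P = +-cancelʳ-≤ L y P (≤-trans y+L≤N N≤P+L)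
    x+y≤N : x + y ≤ N
    x+y≤N = +-cancelʳ-≤ N (x + y) N (begin
      x + y + N             ≤⟨ +-monoʳ-≤ (x + y) N≤P+L ⟩
      x + y + (P + L)       ≡⟨ interchange x y P L ⟩
      (x + P) + (y + L)     ≤⟨ +-mono-≤ x+P≤N y+L≤N ⟩
      N + N                 ∎)
      where
      interchange : ∀ x y P L → x + y + (P + L) ≡ (x + P) + (y + L)
      interchange = solve-∀

  sum-bound : ∀ {P L N} → P ≤ N → L ≤ N → (1 ≤ P → 1 ≤ L → ¬ (N ≤ P + L)) → P + L ≤ N
  sum-bound {zero}          _   L≤N _     = L≤N
  sum-bound {suc P} {zero}  P≤N _   _     = ≤-trans (≤-reflexive (+-identityʳ (suc P))) P≤N
  sum-bound {suc P} {suc L} _   _   mixed = <⇒≤ (≰⇒> (mixed (s≤s z≤n) (s≤s z≤n)))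

  sum-extremal : ∀ {P L N} → P + L ≡ N → (1 ≤ P → 1 ≤ L → ¬ (N ≤ P + L)) →
                 (L ≡ 0 × P ≡ N) ⊎ (P ≡ 0 × L ≡ N)
  sum-extremal {zero}          P+L≡N _     = inj₂ (refl , P+L≡N)
  sum-extremal {suc P} {zero}  P+L≡N _     = inj₁ (refl , trans (sym (+-identityʳ (suc P))) P+L≡N)
  sum-extremal {suc P} {suc L} P+L≡N mixed = ⊥-elim (mixed (s≤s z≤n) (s≤s z≤n) (≤-reflexive (sym P+L≡N)))

  m+n≤n⇒m≡0 : ∀ {m n} → m + n ≤ n → m ≡ 0
  m+n≤n⇒m≡0 {m} {n} m+n≤n = n≤0⇒n≡0 (+-cancelʳ-≤ n m 0 m+n≤n)

module Enumerations where

  open import Data.Nat as ℕ using (zero; suc; _+_; _≤_)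
  import Data.Nat.Properties as ℕ
  open import Data.Fin using (Fin; zero; suc; inject≤)
  import Data.Fin.Properties as Fin
  open import Data.Product using (Σ; ∃; _×_; _,_; proj₁; proj₂)
  open import Data.Empty using (⊥-elim)
  open import Function using (_∘_)
  open import Function.Definitions using (Injective)
  open import Relation.Nullary using (¬_; yes; no)
  open import Relation.Unary using (Pred; Decidable; ∁)
  open import Relation.Binary.PropositionalEquality

  record Enumeration {n : ℕ} (P : Pred (Fin n) 0ℓ) : Set where
    field
      size      : ℕ
      element   : Fin size → Fin n
      injective : Injective _≡_ _≡_ element
      sound     : ∀ r → P (element r)
      complete  : ∀ {t} → P t → ∃ λ r → element r ≡ t

    index : ∀ {t} → P t → Fin size
    index = proj₁ ∘ complete

    element-index : ∀ {t} (p : P t) → element (index p) ≡ t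
    element-index = proj₂ ∘ complete

    index-injective : ∀ {t t′} {p : P t} {p′ : P t′} → index p ≡ index p′ → t ≡ t′
    index-injective {p = p} {p′} eq = trans (sym (element-index p)) (trans (cong element eq) (element-index p′))

    injection≤size : ∀ {m} (f : Fin m → Fin n) → Injective _≡_ _≡_ f → (∀ i → P (f i)) → m ≤ size
    injection≤size f f-injective f∈P = Fin.injective⇒≤ {f = index ∘ f∈P} (f-injective ∘ index-injective)

    size≡0⇒empty : size ≡ 0 → ∀ {t} → ¬ P t
    size≡0⇒empty size≡0 p = Fin.¬Fin0 (subst Fin size≡0 (index p))

    prefix : ∀ {m} → m ≤ size → Σ (Fin m → Fin n) λ f → Injective _≡_ _≡_ f × (∀ i → P (f i))
    prefix m≤size = element ∘ embed , injective-prefix , sound ∘ embed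
      where
      embed = λ i → inject≤ i m≤size
      injective-prefix : Injective _≡_ _≡_ (element ∘ embed)
      injective-prefix eq = Fin.inject≤-injective m≤size m≤size _ _ (injective eq)

  open Enumeration

  module _ {n : ℕ} {P : Pred (Fin (suc n)) 0ℓ} where

    enumerate-without-zero : ¬ P zero → Enumeration (P ∘ suc) → Enumeration P
    enumerate-without-zero ¬P0 E = record
      { size = size E ; element = suc ∘ element E
      ; injective = injective E ∘ Fin.suc-injective
      ; sound = sound E ; complete = complete′ }
      where
      complete′ : ∀ {t} → P t → ∃ λ r → suc (element E r) ≡ t
      complete′ {zero}  p = ⊥-elim (¬P0 p)
      complete′ {suc t} p = index E p , cong suc (element-index E p)

    enumerate-with-zero : P zero → Enumeration (P ∘ suc) → Enumeration P
    enumerate-with-zero P0 E = record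
      { size = suc (size E) ; element = element′
      ; injective = injective′ ; sound = sound′ ; complete = complete′ }
      where
      element′ : Fin (suc (size E)) → Fin (suc n)
      element′ zero    = zero
      element′ (suc r) = suc (element E r)
      injective′ : Injective _≡_ _≡_ element′
      injective′ {zero}  {zero}  _  = refl
      injective′ {zero}  {suc _} ()
      injective′ {suc _} {zero}  ()
      injective′ {suc _} {suc _} eq = cong suc (injective E (Fin.suc-injective eq))
      sound′ : ∀ r → P (element′ r)
      sound′ zero    = P0
      sound′ (suc r) = sound E r
      complete′ : ∀ {t} → P t → ∃ λ r → element′ r ≡ t
      complete′ {zero}  _ = zero , refl
      complete′ {suc t} p = suc (index E p) , cong suc (element-index E p)

  record Partition {n : ℕ} (P : Pred (Fin n) 0ℓ) : Set where
    field
      inside  : Enumeration P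
      outside : Enumeration (∁ P)
      sizes   : size inside + size outside ≡ n

  partition : ∀ {n} {P : Pred (Fin n) 0ℓ} → Decidable P → Partition P
  partition {zero} P? = record { inside = none ; outside = none ; sizes = refl }
    where
    none : ∀ {Q} → Enumeration Q
    none = record { size = 0 ; element = λ () ; injective = λ {} ; sound = λ () ; complete = λ {t} → ⊥-elim (Fin.¬Fin0 t) }
  partition {suc n} P? with partition (P? ∘ suc) | P? zero
  ... | record { inside = E ; outside = E′ ; sizes = e } | yes P0 = record
    { inside = enumerate-with-zero P0 E ; outside = enumerate-without-zero (λ ¬P0 → ¬P0 P0) E′ ; sizes = cong suc e }
  ... | record { inside = E ; outside = E′ ; sizes = e } | no ¬P0 = record
    { inside = enumerate-without-zero ¬P0 E ; outside = enumerate-with-zero ¬P0 E′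
    ; sizes = trans (ℕ.+-suc (size E) (size E′)) (cong suc e) }

module Incidence where

  open import Level using (0ℓ)
  open import Data.Nat as ℕ using (ℕ; suc; _+_; _*_; _∸_; _≤_; _<_)
  import Data.Nat.Properties as ℕ
  open import Data.Fin as Fin using (Fin; punchIn; combine; remQuot)
  import Data.Fin.Properties as Fin
  open import Data.Product using (Σ; ∃; _×_; _,_; proj₁; proj₂; map₂; uncurry)
  open import Data.Sum as Sum using (_⊎_)
  open import Data.Empty using (⊥)
  open import Function using (_∘_)
  open import Function.Definitions using (Injective)
  open import Relation.Nullary using (¬_; yes; no)
  open import Relation.Nullary.Decidable using (decidable-stable)
  open import Relation.Unary using (Pred; Decidable)
  open import Relation.Binary.PropositionalEquality

  open Arithmetic
  open Enumerations
  open Enumeration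

  private
    remQuot-injective : ∀ {m} n → Injective _≡_ _≡_ (remQuot {m} n)
    remQuot-injective {m} n {i} {j} eq =
      trans (sym (Fin.combine-remQuot {m} n i)) (trans (cong (uncurry combine) eq) (Fin.combine-remQuot {m} n j))

  record IncidenceStructure (q v b : ℕ) : Set₁ where
    field
      _I_            : Fin v → Fin b → Set
      points-on      : ∀ B → Σ (Fin (suc q) → Fin v) λ h → Injective _≡_ _≡_ h × (∀ t → h t I B)
      blocks-through : ∀ p → Σ (Fin (suc q) → Fin b) λ h → Injective _≡_ _≡_ h × (∀ t → p I h t)
      one-common-block : ∀ {p p′ B B′} → p ≢ p′ → B ≢ B′ → p I B → p′ I B → p I B′ → p′ I B′ → ⊥

  dual : ∀ {q v b} → IncidenceStructure q v b → IncidenceStructure q b v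
  dual S = record
    { _I_ = λ B p → p I B
    ; points-on = blocks-through
    ; blocks-through = points-on
    ; one-common-block = λ B≢B′ p≢p′ i₁ i₂ i₃ i₄ → one-common-block p≢p′ B≢B′ i₁ i₃ i₂ i₄
    }
    where open IncidenceStructure S

  -- Each chosen block carries at least 2 + (q ∸ l) unchosen points, and an
  -- ordered pair of distinct points determines its block, so the unchosen
  -- points carry L * pairs (q ∸ l) distinct ordered pairs.
  module ChainFree {q v b : ℕ} (S : IncidenceStructure q v b) (l : ℕ) (l≤q : l ≤ q)
    {P L : ℕ} (a : Fin P → Fin v) (a-injective : Injective _≡_ _≡_ a)
    (β : Fin L → Fin b) (β-injective : Injective _≡_ _≡_ β)
    (Λ-free : ∀ j (ψ : Fin l → Fin P) → Injective _≡_ _≡_ ψ → ¬ (∀ s → IncidenceStructure._I_ S (a (ψ s)) (β j)))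
    where
    open IncidenceStructure S

    Chosen : Pred (Fin v) 0ℓ
    Chosen p = ∃ λ i → a i ≡ p

    chosen? : Decidable Chosen
    chosen? p = Fin.any? λ i → a i Fin.≟ p

    open Partition (partition chosen?) public renaming (inside to chosen; outside to unchosen; sizes to chosen+unchosen≡v)

    unchosen+P≤v : size unchosen + P ≤ v
    unchosen+P≤v = begin
      size unchosen + P              ≤⟨ ℕ.+-monoʳ-≤ _ (injection≤size chosen a a-injective (λ i → i , refl)) ⟩
      size unchosen + size chosen    ≡⟨ ℕ.+-comm (size unchosen) _ ⟩
      size chosen + size unchosen    ≡⟨ chosen+unchosen≡v ⟩
      v                              ∎
      where open ℕ.≤-Reasoning

    no-unchosen⇒surjective : size unchosen ≡ 0 → ∀ p → Chosen p
    no-unchosen⇒surjective none p = decidable-stable (chosen? p) (size≡0⇒empty unchosen none)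

    s : ℕ
    s = q ∸ l

    module OnBlock (j : Fin L) where
      h : Fin (suc q) → Fin v
      h = proj₁ (points-on (β j))

      h-injective : Injective _≡_ _≡_ h
      h-injective = proj₁ (proj₂ (points-on (β j)))

      h-on : ∀ t → h t I β j
      h-on = proj₂ (proj₂ (points-on (β j)))

      open Partition (partition (chosen? ∘ h)) renaming (inside to old; outside to new; sizes to old+new≡1+q)

      old<l : size old < l
      old<l = ℕ.≰⇒> λ l≤old →
        let (ψ , ψ-injective , ψ-chosen) = prefix old l≤old
            index-of = λ s → proj₁ (ψ-chosen s)
            index-of-spec = λ s → proj₂ (ψ-chosen s)
        in Λ-free j index-of
             (λ eq → ψ-injective (h-injective (trans (sym (index-of-spec _)) (trans (cong a eq) (index-of-spec _)))))
             (λ s → subst (_I β j) (sym (index-of-spec s)) (h-on (ψ s)))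

      new-points : Σ (Fin (2 + s) → Fin (suc q)) λ f → Injective _≡_ _≡_ f × (∀ i → ¬ Chosen (h (f i)))
      new-points = prefix new (complement-lower-bound q l (size new) (size old) old+new≡1+q old<l l≤q)

      fresh : Fin (2 + s) → Fin v
      fresh = h ∘ proj₁ new-points

      fresh-injective : Injective _≡_ _≡_ fresh
      fresh-injective = proj₁ (proj₂ new-points) ∘ h-injective

      fresh-unchosen : ∀ σ → ¬ Chosen (fresh σ)
      fresh-unchosen = proj₂ (proj₂ new-points)

      fresh-on : ∀ σ → fresh σ I β j
      fresh-on σ = h-on _

    open OnBlock using (fresh; fresh-injective; fresh-unchosen; fresh-on)

    pair-of : Fin L × Fin (2 + s) × Fin (1 + s) → Fin (size unchosen) × Fin (size unchosen)
    pair-of (j , σ , τ) = index unchosen (fresh-unchosen j σ) , index unchosen (fresh-unchosen j (punchIn σ τ))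

    same-block : ∀ {j j′ σ σ′ τ τ′} → fresh j σ ≡ fresh j′ σ′ →
                 fresh j (punchIn σ τ) ≡ fresh j′ (punchIn σ′ τ′) → j ≡ j′
    same-block {j} {j′} {σ} {σ′} {τ} {τ′} e₁ e₂ = decidable-stable (j Fin.≟ j′) λ j≢j′ →
      one-common-block (λ e → Fin.punchInᵢ≢i σ τ (sym (fresh-injective j e))) (j≢j′ ∘ β-injective)
        (fresh-on j σ) (fresh-on j _)
        (subst (_I β j′) (sym e₁) (fresh-on j′ σ′)) (subst (_I β j′) (sym e₂) (fresh-on j′ _))

    same-fresh-pair : ∀ {j j′ σ σ′ τ τ′} → fresh j σ ≡ fresh j′ σ′ →
                      fresh j (punchIn σ τ) ≡ fresh j′ (punchIn σ′ τ′) →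
                      (j , σ , τ) ≡ (j′ , σ′ , τ′)
    same-fresh-pair {j} {j′} {σ} {σ′} {τ} {τ′} e₁ e₂ = cong₂ _,_ j≡j′ (cong₂ _,_ σ≡σ′ τ≡τ′)
      where
      j≡j′ = same-block e₁ e₂
      on-j : ∀ {ρ ρ′} → fresh j ρ ≡ fresh j′ ρ′ → ρ ≡ ρ′
      on-j e = fresh-injective j (trans e (cong (λ k → fresh k _) (sym j≡j′)))
      σ≡σ′ = on-j e₁
      τ≡τ′ = Fin.punchIn-injective σ τ τ′ (trans (on-j e₂) (cong (λ σ → punchIn σ τ′) (sym σ≡σ′)))

    pair-of-injective : Injective _≡_ _≡_ pair-of
    pair-of-injective eq =
      same-fresh-pair (index-injective unchosen (cong proj₁ eq)) (index-injective unchosen (cong proj₂ eq))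

    L*pairs≤unchosen² : L * pairs s ≤ size unchosen * size unchosen
    L*pairs≤unchosen² = Fin.injective⇒≤ {f = embedding} embedding-injective
      where
      split : Fin (L * pairs s) → Fin L × Fin (2 + s) × Fin (1 + s)
      split = map₂ (remQuot (1 + s)) ∘ remQuot (pairs s)
      split-injective : Injective _≡_ _≡_ split
      split-injective eq = remQuot-injective (pairs s)
        (cong₂ _,_ (cong proj₁ eq) (remQuot-injective (1 + s) (cong proj₂ eq)))
      embedding : Fin (L * pairs s) → Fin (size unchosen * size unchosen)
      embedding = uncurry combine ∘ pair-of ∘ split
      embedding-injective : Injective _≡_ _≡_ embedding
      embedding-injective eq = split-injective (pair-of-injective
        (uncurry (cong₂ _,_) (Fin.combine-injective _ _ _ _ eq)))

  module ChainFreeFamily {q : ℕ} (S : IncidenceStructure q (q * q + q + 1) (q * q + q + 1))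
    (k l : ℕ) (k≤q : k ≤ q) (l≤q : l ≤ q)
    (q²≤2[q∸k]² : q * q ≤ 2 * ((q ∸ k) * (q ∸ k))) (q²≤2[q∸l]² : q * q ≤ 2 * ((q ∸ l) * (q ∸ l)))
    {P L : ℕ} (a : Fin P → Fin (q * q + q + 1)) (a-injective : Injective _≡_ _≡_ a)
    (β : Fin L → Fin (q * q + q + 1)) (β-injective : Injective _≡_ _≡_ β)
    (V-free : ∀ i (ψ : Fin k → Fin L) → Injective _≡_ _≡_ ψ → ¬ (∀ s → IncidenceStructure._I_ S (a i) (β (ψ s))))
    (Λ-free : ∀ j (ψ : Fin l → Fin P) → Injective _≡_ _≡_ ψ → ¬ (∀ s → IncidenceStructure._I_ S (a (ψ s)) (β j)))
    where

    private
      N = q * q + q + 1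
      module Points = ChainFree S l l≤q a a-injective β β-injective Λ-free
      module Blocks = ChainFree (dual S) k k≤q β β-injective a a-injective V-free

    not-both-nonempty : 1 ≤ P → 1 ≤ L → ¬ (N ≤ P + L)
    not-both-nonempty = both-sides-large⇒⊥ q q²≤2[q∸l]² q²≤2[q∸k]²
      Points.unchosen+P≤v Points.L*pairs≤unchosen² Blocks.unchosen+P≤v Blocks.L*pairs≤unchosen²

    size-bound : P + L ≤ N
    size-bound = sum-bound (ℕ.≤-trans (ℕ.m≤n+m P _) Points.unchosen+P≤v)
                           (ℕ.≤-trans (ℕ.m≤n+m L _) Blocks.unchosen+P≤v) not-both-nonempty

    extremal : P + L ≡ N → (L ≡ 0 × ∀ p → ∃ λ i → a i ≡ p) ⊎ (P ≡ 0 × ∀ B → ∃ λ j → β j ≡ B)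
    extremal P+L≡N = Sum.map only-points only-blocks (sum-extremal P+L≡N not-both-nonempty)
      where
      only-points : L ≡ 0 × P ≡ N → L ≡ 0 × ∀ p → ∃ λ i → a i ≡ p
      only-points (L≡0 , P≡N) = L≡0 , Points.no-unchosen⇒surjective
        (m+n≤n⇒m≡0 (subst (λ n → size Points.unchosen + P ≤ n) (sym P≡N) Points.unchosen+P≤v))
      only-blocks : P ≡ 0 × L ≡ N → P ≡ 0 × ∀ B → ∃ λ j → β j ≡ B
      only-blocks (P≡0 , L≡N) = P≡0 , Blocks.no-unchosen⇒surjective
        (m+n≤n⇒m≡0 (subst (λ n → size Blocks.unchosen + L ≤ n) (sym L≡N) Blocks.unchosen+P≤v))

module Vectors {q : ℕ} (𝔽 : FiniteField q) where

  open import Data.Integer using (+_)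
  open import Data.Fin using (Fin; zero; suc)
  import Data.Fin.Properties as Fin
  open import Data.Product using (∃; ∃₂; _×_; _,_; proj₁; proj₂)
  open import Data.Empty using (⊥; ⊥-elim)
  open import Relation.Nullary using (¬_; Dec; yes; no)
  open import Relation.Nullary.Decidable using (decidable-stable)

  open FiniteField 𝔽 hiding (zero)
  open Geometry 𝔽
  open IntegerCoefficientSolver cring using (solve; _:+_; _:*_; :-_; _:-_; _:=_; con)
  open import Relation.Binary.Reasoning.Setoid setoid
  open import Algebra.Properties.Group +-group using (x∙y⁻¹≈ε⇒x≈y)

  1≉0 : ¬ (1# ≈ 0#)
  1≉0 1≈0 = 0≉1 (sym 1≈0)

  ≉0-*-cancelˡ : ∀ {a} → ¬ (a ≈ 0#) → (∀ {x y} → a * x ≈ a * y → x ≈ y)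
  ≉0-*-cancelˡ {a} a≉0 {x} {y} ax≈ay with inverse a a≉0
  ... | r , ar≈1 = begin
    x                ≈⟨ *-identityˡ x ⟨
    1# * x           ≈⟨ *-congʳ (trans (sym ar≈1) (*-comm a r)) ⟩
    (r * a) * x      ≈⟨ *-assoc r a x ⟩
    r * (a * x)      ≈⟨ *-congˡ ax≈ay ⟩
    r * (a * y)      ≈⟨ *-assoc r a y ⟨
    (r * a) * y      ≈⟨ *-congʳ (trans (*-comm r a) ar≈1) ⟩
    1# * y           ≈⟨ *-identityˡ y ⟩
    y                ∎

  vec : Carrier → Carrier → Carrier → V
  vec a b c zero             = a
  vec a b c (suc zero)       = b
  vec a b c (suc (suc zero)) = c

  i₀ i₁ i₂ : Fin 3
  i₀ = zero
  i₁ = suc zero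
  i₂ = suc (suc zero)

  dot : V → V → Carrier
  dot n x = n i₀ * x i₀ + n i₁ * x i₁ + n i₂ * x i₂

  cross : V → V → V
  cross u w = vec (u i₁ * w i₂ - u i₂ * w i₁) (u i₂ * w i₀ - u i₀ * w i₂) (u i₀ * w i₁ - u i₁ * w i₀)

  -- Definitionally x ∈ line v _.
  _∝_ : V → V → Set
  x ∝ v = ∃ λ a → ∀ i → x i ≈ a * v i

  isZero? : ∀ v → Dec (IsZero v)
  isZero? v = Fin.all? λ i → v i ≟ 0#

  nonzero-coordinate : ∀ {v} → ¬ IsZero v → ∃ λ i → ¬ (v i ≈ 0#)
  nonzero-coordinate {v} = Fin.¬∀⟶∃¬ 3 _ (λ i → v i ≟ 0#)

  ∝-trans : ∀ {x v w} → x ∝ v → v ∝ w → x ∝ w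
  ∝-trans (a , x≈av) (b , v≈bw) = a * b , λ i → trans (x≈av i) (trans (*-congˡ (v≈bw i)) (sym (*-assoc _ _ _)))

  ∝-scalar≉0 : ∀ {x v} → ¬ IsZero x → (x∝v : x ∝ v) → ¬ (proj₁ x∝v ≈ 0#)
  ∝-scalar≉0 x≉0 (a , x≈av) a≈0 = x≉0 λ i → trans (x≈av i) (trans (*-congʳ a≈0) (zeroˡ _))

  ∝-sym : ∀ {x v} → ¬ IsZero x → x ∝ v → v ∝ x
  ∝-sym {x} {v} x≉0 x∝v@(a , x≈av) with inverse a (∝-scalar≉0 x≉0 x∝v)
  ... | r , ar≈1 = r , λ i → begin
    v i              ≈⟨ *-identityʳ (v i) ⟨
    v i * 1#         ≈⟨ *-congˡ (sym ar≈1) ⟩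
    v i * (a * r)    ≈⟨ solve 3 (λ v a r → v :* (a :* r) := r :* (a :* v)) refl (v i) a r ⟩
    r * (a * v i)    ≈⟨ *-congˡ (sym (x≈av i)) ⟩
    r * x i          ∎

  dot-comm : ∀ n x → dot n x ≈ dot x n
  dot-comm n x = +-cong (+-cong (*-comm _ _) (*-comm _ _)) (*-comm _ _)

  dot-congʳ : ∀ n {x y} → (∀ i → x i ≈ y i) → dot n x ≈ dot n y
  dot-congʳ n x≈y = +-cong (+-cong (*-congˡ (x≈y i₀)) (*-congˡ (x≈y i₁))) (*-congˡ (x≈y i₂))

  dot-∝ʳ : ∀ n {x v} → x ∝ v → dot n v ≈ 0# → dot n x ≈ 0#
  dot-∝ʳ n {x} {v} (a , x≈av) nv≈0 = begin
    dot n x                                                  ≈⟨ dot-congʳ n x≈av ⟩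
    n i₀ * (a * v i₀) + n i₁ * (a * v i₁) + n i₂ * (a * v i₂) ≈⟨ pull-scalar a (n i₀) (n i₁) (n i₂) (v i₀) (v i₁) (v i₂) ⟩
    a * dot n v                                              ≈⟨ *-congˡ nv≈0 ⟩
    a * 0#                                                   ≈⟨ zeroʳ a ⟩
    0#                                                       ∎
    where
    pull-scalar = solve 7 (λ a n₀ n₁ n₂ v₀ v₁ v₂ →
      n₀ :* (a :* v₀) :+ n₁ :* (a :* v₁) :+ n₂ :* (a :* v₂) := a :* (n₀ :* v₀ :+ n₁ :* v₁ :+ n₂ :* v₂)) refl

  dot-∝ˡ : ∀ {n m} x → m ∝ n → dot n x ≈ 0# → dot m x ≈ 0#
  dot-∝ˡ {n} {m} x m∝n nx≈0 = trans (dot-comm m x) (dot-∝ʳ x m∝n (trans (dot-comm x n) nx≈0))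

  private
    rescale : ∀ {mᵢ mⱼ uᵢ uⱼ} r → mᵢ * r ≈ 1# → mᵢ * uⱼ ≈ mⱼ * uᵢ → uⱼ ≈ (uᵢ * r) * mⱼ
    rescale {mᵢ} {mⱼ} {uᵢ} {uⱼ} r mᵢr≈1 mᵢuⱼ≈mⱼuᵢ = begin
      uⱼ              ≈⟨ *-identityʳ uⱼ ⟨
      uⱼ * 1#         ≈⟨ *-congˡ (sym mᵢr≈1) ⟩
      uⱼ * (mᵢ * r)   ≈⟨ solve 3 (λ uⱼ mᵢ r → uⱼ :* (mᵢ :* r) := (mᵢ :* uⱼ) :* r) refl uⱼ mᵢ r ⟩
      (mᵢ * uⱼ) * r   ≈⟨ *-congʳ mᵢuⱼ≈mⱼuᵢ ⟩
      (mⱼ * uᵢ) * r   ≈⟨ solve 3 (λ mⱼ uᵢ r → (mⱼ :* uᵢ) :* r := (uᵢ :* r) :* mⱼ) refl mⱼ uᵢ r ⟩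
      (uᵢ * r) * mⱼ   ∎

    difference≈0 : ∀ {x y} → x - y ≈ 0# → x ≈ y
    difference≈0 = x∙y⁻¹≈ε⇒x≈y _ _

  -- All 2 × 2 minors of (m u) vanish, so u = (uₖ / mₖ) m for any mₖ ≉ 0.
  cross≈0⇒∝ : ∀ {m u} → ¬ IsZero m → IsZero (cross m u) → u ∝ m
  cross≈0⇒∝ {m} {u} m≉0 m×u≈0 with nonzero-coordinate m≉0
  ... | zero , m₀≉0 = let (r , m₀r≈1) = inverse _ m₀≉0 in u i₀ * r , λ
        { zero             → rescale r m₀r≈1 refl
        ; (suc zero)       → rescale r m₀r≈1 (difference≈0 (m×u≈0 i₂))
        ; (suc (suc zero)) → rescale r m₀r≈1 (sym (difference≈0 (m×u≈0 i₁))) }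
  ... | suc zero , m₁≉0 = let (r , m₁r≈1) = inverse _ m₁≉0 in u i₁ * r , λ
        { zero             → rescale r m₁r≈1 (sym (difference≈0 (m×u≈0 i₂)))
        ; (suc zero)       → rescale r m₁r≈1 refl
        ; (suc (suc zero)) → rescale r m₁r≈1 (difference≈0 (m×u≈0 i₀)) }
  ... | suc (suc zero) , m₂≉0 = let (r , m₂r≈1) = inverse _ m₂≉0 in u i₂ * r , λ
        { zero             → rescale r m₂r≈1 (difference≈0 (m×u≈0 i₁))
        ; (suc zero)       → rescale r m₂r≈1 (sym (difference≈0 (m×u≈0 i₀)))
        ; (suc (suc zero)) → rescale r m₂r≈1 refl }

  independent⇒cross≉0 : ∀ {u w} → Independent u w → ¬ IsZero (cross u w)
  independent⇒cross≉0 {u} {w} u⊥w u×w≈0 with isZero? u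
  ... | yes u≈0 = 1≉0 (proj₁ (u⊥w 1# 0# λ i → begin
        1# * u i + 0# * w i   ≈⟨ +-cong (*-congˡ (u≈0 i)) (zeroˡ (w i)) ⟩
        1# * 0# + 0#          ≈⟨ trans (+-identityʳ _) (zeroʳ 1#) ⟩
        0#                    ∎))
  ... | no u≉0 with cross≈0⇒∝ u≉0 u×w≈0
  ... | c , w≈cu = 1≉0 (proj₂ (u⊥w (- c) 1# λ i → begin
        - c * u i + 1# * w i        ≈⟨ +-congˡ (*-congˡ (w≈cu i)) ⟩
        - c * u i + 1# * (c * u i)  ≈⟨ solve 2 (λ c x → :- c :* x :+ con (+ 1) :* (c :* x) := con (+ 0)) refl c (u i) ⟩
        0#                          ∎))

  ¬∝⇒independent : ∀ {u w} → ¬ IsZero w → ¬ (u ∝ w) → Independent u w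
  ¬∝⇒independent {u} {w} w≉0 u≁w a b au+bw≈0 with a ≟ 0#
  ... | yes a≈0 = a≈0 , decidable-stable (b ≟ 0#) λ b≉0 → w≉0 λ i → ≉0-*-cancelˡ b≉0 (trans (bw≈0 i) (sym (zeroʳ b)))
    where
    bw≈0 : ∀ i → b * w i ≈ 0#
    bw≈0 i = begin
      b * w i            ≈⟨ +-identityˡ _ ⟨
      0# + b * w i       ≈⟨ +-congʳ (trans (*-congʳ a≈0) (zeroˡ (u i))) ⟨
      a * u i + b * w i  ≈⟨ au+bw≈0 i ⟩
      0#                 ∎
  ... | no a≉0 = ⊥-elim (u≁w (let (r , ar≈1) = inverse a a≉0 in - (r * b) , λ i → begin
      u i                                       ≈⟨ *-identityʳ (u i) ⟨
      u i * 1#                                  ≈⟨ *-congˡ (sym ar≈1) ⟩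
      u i * (a * r)                             ≈⟨ solve 5 (λ u a r b w → u :* (a :* r) := r :* (a :* u :+ b :* w) :+ :- (r :* b) :* w) refl (u i) a r b (w i) ⟩
      r * (a * u i + b * w i) + - (r * b) * w i  ≈⟨ +-congʳ (*-congˡ (au+bw≈0 i)) ⟩
      r * 0# + - (r * b) * w i                   ≈⟨ trans (+-congʳ (zeroʳ r)) (+-identityˡ _) ⟩
      - (r * b) * w i                            ∎))

  -- Definitionally x ∈ plane u w _.
  InSpan : V → V → V → Set
  InSpan u w x = ∃₂ λ a b → ∀ i → x i ≈ a * u i + b * w i

  span⇒dot-cross≈0 : ∀ {u w x} → InSpan u w x → dot (cross u w) x ≈ 0#
  span⇒dot-cross≈0 {u} {w} {x} (a , b , x≈au+bw) = trans (dot-congʳ (cross u w) x≈au+bw)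
    (solve 8 (λ a b u₀ u₁ u₂ w₀ w₁ w₂ →
       (u₁ :* w₂ :- u₂ :* w₁) :* (a :* u₀ :+ b :* w₀) :+ (u₂ :* w₀ :- u₀ :* w₂) :* (a :* u₁ :+ b :* w₁)
       :+ (u₀ :* w₁ :- u₁ :* w₀) :* (a :* u₂ :+ b :* w₂) := con (+ 0))
     refl a b (u i₀) (u i₁) (u i₂) (w i₀) (w i₁) (w i₂))

  -- Cramer's rule, solving with the third minor u₀ w₁ - u₁ w₀ = r⁻¹; the third
  -- coordinate equation is where dot (cross u w) x ≈ 0 is needed.
  private
    cramer : ∀ u₀ u₁ u₂ w₀ w₁ w₂ x₀ x₁ x₂ r → (u₀ * w₁ - u₁ * w₀) * r ≈ 1# →
      (u₁ * w₂ - u₂ * w₁) * x₀ + (u₂ * w₀ - u₀ * w₂) * x₁ + (u₀ * w₁ - u₁ * w₀) * x₂ ≈ 0# →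
      ∃₂ λ a b → (x₀ ≈ a * u₀ + b * w₀) × (x₁ ≈ a * u₁ + b * w₁) × (x₂ ≈ a * u₂ + b * w₂)
    cramer u₀ u₁ u₂ w₀ w₁ w₂ x₀ x₁ x₂ r Δr≈1 det≈0 = a , b , solved₀ , solved₁ , solved₂
      where
      a = (x₀ * w₁ - x₁ * w₀) * r
      b = (u₀ * x₁ - u₁ * x₀) * r
      Δ = u₀ * w₁ - u₁ * w₀
      det = (u₁ * w₂ - u₂ * w₁) * x₀ + (u₂ * w₀ - u₀ * w₂) * x₁ + (u₀ * w₁ - u₁ * w₀) * x₂
      x*Δr≈x : ∀ x → x * (Δ * r) ≈ x
      x*Δr≈x x = trans (*-congˡ Δr≈1) (*-identityʳ x)
      solved₀ : x₀ ≈ a * u₀ + b * w₀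
      solved₀ = sym (trans (solve 7 (λ u₀ u₁ w₀ w₁ x₀ x₁ r →
        (x₀ :* w₁ :- x₁ :* w₀) :* r :* u₀ :+ (u₀ :* x₁ :- u₁ :* x₀) :* r :* w₀ := x₀ :* ((u₀ :* w₁ :- u₁ :* w₀) :* r))
        refl u₀ u₁ w₀ w₁ x₀ x₁ r) (x*Δr≈x x₀))
      solved₁ : x₁ ≈ a * u₁ + b * w₁
      solved₁ = sym (trans (solve 7 (λ u₀ u₁ w₀ w₁ x₀ x₁ r →
        (x₀ :* w₁ :- x₁ :* w₀) :* r :* u₁ :+ (u₀ :* x₁ :- u₁ :* x₀) :* r :* w₁ := x₁ :* ((u₀ :* w₁ :- u₁ :* w₀) :* r))
        refl u₀ u₁ w₀ w₁ x₀ x₁ r) (x*Δr≈x x₁))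
      solved₂ : x₂ ≈ a * u₂ + b * w₂
      solved₂ = sym (begin
        a * u₂ + b * w₂         ≈⟨ solve 10 (λ u₀ u₁ u₂ w₀ w₁ w₂ x₀ x₁ x₂ r →
            (x₀ :* w₁ :- x₁ :* w₀) :* r :* u₂ :+ (u₀ :* x₁ :- u₁ :* x₀) :* r :* w₂
            := x₂ :* ((u₀ :* w₁ :- u₁ :* w₀) :* r) :- r :* ((u₁ :* w₂ :- u₂ :* w₁) :* x₀
               :+ (u₂ :* w₀ :- u₀ :* w₂) :* x₁ :+ (u₀ :* w₁ :- u₁ :* w₀) :* x₂))
            refl u₀ u₁ u₂ w₀ w₁ w₂ x₀ x₁ x₂ r ⟩
        x₂ * (Δ * r) - r * det  ≈⟨ +-cong (x*Δr≈x x₂) (-‿cong (trans (*-congˡ det≈0) (zeroʳ r))) ⟩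
        x₂ - 0#                 ≈⟨ solve 1 (λ x → x :- con (+ 0) := x) refl x₂ ⟩
        x₂                      ∎)

    rotate-sum : ∀ a b c → a + b + c ≈ b + c + a
    rotate-sum = solve 3 (λ a b c → a :+ b :+ c := b :+ c :+ a) refl

  dot-cross≈0⇒span : ∀ {u w x} → Independent u w → dot (cross u w) x ≈ 0# → InSpan u w x
  dot-cross≈0⇒span {u} {w} {x} u⊥w det≈0 with nonzero-coordinate (independent⇒cross≉0 u⊥w)
  ... | zero , Δ≉0 =
    let (r , Δr≈1) = inverse _ Δ≉0
        (a , b , e₁ , e₂ , e₀) = cramer (u i₁) (u i₂) (u i₀) (w i₁) (w i₂) (w i₀) (x i₁) (x i₂) (x i₀) r Δr≈1
                                   (trans (sym (rotate-sum _ _ _)) det≈0)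
    in a , b , λ { zero → e₀ ; (suc zero) → e₁ ; (suc (suc zero)) → e₂ }
  ... | suc zero , Δ≉0 =
    let (r , Δr≈1) = inverse _ Δ≉0
        (a , b , e₂ , e₀ , e₁) = cramer (u i₂) (u i₀) (u i₁) (w i₂) (w i₀) (w i₁) (x i₂) (x i₀) (x i₁) r Δr≈1
                                   (trans (rotate-sum _ _ _) det≈0)
    in a , b , λ { zero → e₀ ; (suc zero) → e₁ ; (suc (suc zero)) → e₂ }
  ... | suc (suc zero) , Δ≉0 =
    let (r , Δr≈1) = inverse _ Δ≉0
        (a , b , e₀ , e₁ , e₂) = cramer (u i₀) (u i₁) (u i₂) (w i₀) (w i₁) (w i₂) (x i₀) (x i₁) (x i₂) r Δr≈1 det≈0
    in a , b , λ { zero → e₀ ; (suc zero) → e₁ ; (suc (suc zero)) → e₂ }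

  -- (n × n′) × x = (n·x) n′ − (n′·x) n
  cross-cross≈0 : ∀ n n′ x → dot n x ≈ 0# → dot n′ x ≈ 0# → IsZero (cross (cross n n′) x)
  cross-cross≈0 n n′ x nx≈0 n′x≈0 i = begin
    cross (cross n n′) x i             ≈⟨ expand i ⟩
    n′ i * dot n x - n i * dot n′ x    ≈⟨ +-cong (*-congˡ nx≈0) (-‿cong (*-congˡ n′x≈0)) ⟩
    n′ i * 0# - n i * 0#               ≈⟨ solve 2 (λ a b → a :* con (+ 0) :- b :* con (+ 0) := con (+ 0)) refl (n′ i) (n i) ⟩
    0#                                 ∎
    where
    expand : ∀ i → cross (cross n n′) x i ≈ n′ i * dot n x - n i * dot n′ x
    expand zero = solve 9 (λ n₀ n₁ n₂ m₀ m₁ m₂ x₀ x₁ x₂ →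
      (n₂ :* m₀ :- n₀ :* m₂) :* x₂ :- (n₀ :* m₁ :- n₁ :* m₀) :* x₁
      := m₀ :* (n₀ :* x₀ :+ n₁ :* x₁ :+ n₂ :* x₂) :- n₀ :* (m₀ :* x₀ :+ m₁ :* x₁ :+ m₂ :* x₂))
      refl (n i₀) (n i₁) (n i₂) (n′ i₀) (n′ i₁) (n′ i₂) (x i₀) (x i₁) (x i₂)
    expand (suc zero) = solve 9 (λ n₀ n₁ n₂ m₀ m₁ m₂ x₀ x₁ x₂ →
      (n₀ :* m₁ :- n₁ :* m₀) :* x₀ :- (n₁ :* m₂ :- n₂ :* m₁) :* x₂
      := m₁ :* (n₀ :* x₀ :+ n₁ :* x₁ :+ n₂ :* x₂) :- n₁ :* (m₀ :* x₀ :+ m₁ :* x₁ :+ m₂ :* x₂))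
      refl (n i₀) (n i₁) (n i₂) (n′ i₀) (n′ i₁) (n′ i₂) (x i₀) (x i₁) (x i₂)
    expand (suc (suc zero)) = solve 9 (λ n₀ n₁ n₂ m₀ m₁ m₂ x₀ x₁ x₂ →
      (n₁ :* m₂ :- n₂ :* m₁) :* x₁ :- (n₂ :* m₀ :- n₀ :* m₂) :* x₀
      := m₂ :* (n₀ :* x₀ :+ n₁ :* x₁ :+ n₂ :* x₂) :- n₂ :* (m₀ :* x₀ :+ m₁ :* x₁ :+ m₂ :* x₂))
      refl (n i₀) (n i₁) (n i₂) (n′ i₀) (n′ i₁) (n′ i₂) (x i₀) (x i₁) (x i₂)

  -- Both x and y are proportional to n × n′, which is nonzero.
  two-points-two-normals : ∀ {x y n n′} → ¬ IsZero y → ¬ (x ∝ y) → ¬ IsZero n′ → ¬ (n ∝ n′) →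
    dot n x ≈ 0# → dot n y ≈ 0# → dot n′ x ≈ 0# → dot n′ y ≈ 0# → ⊥
  two-points-two-normals {x} {y} {n} {n′} y≉0 x≁y n′≉0 n≁n′ nx≈0 ny≈0 n′x≈0 n′y≈0 =
    x≁y (∝-trans x∝n×n′ (∝-sym y≉0 y∝n×n′))
    where
    n×n′≉0 : ¬ IsZero (cross n n′)
    n×n′≉0 = independent⇒cross≉0 (¬∝⇒independent n′≉0 n≁n′)
    x∝n×n′ : x ∝ cross n n′
    x∝n×n′ = cross≈0⇒∝ n×n′≉0 (cross-cross≈0 n n′ x nx≈0 n′x≈0)
    y∝n×n′ : y ∝ cross n n′
    y∝n×n′ = cross≈0⇒∝ n×n′≉0 (cross-cross≈0 n n′ y ny≈0 n′y≈0)

module ProjectivePlane {q : ℕ} (𝔽 : FiniteField q) where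

  open import Data.Nat as ℕ using (ℕ)
  open import Data.Integer using (+_)
  open import Data.Fin as Fin using (Fin; zero; suc; _↑ˡ_; _↑ʳ_; splitAt; join; combine; remQuot)
  import Data.Fin.Properties as Fin
  open import Data.Product using (Σ; ∃; _×_; _,_; proj₁; proj₂)
  open import Data.Sum using (_⊎_; inj₁; inj₂)
  open import Data.Empty using (⊥; ⊥-elim)
  open import Relation.Nullary using (¬_; yes; no)
  open import Function using (_∘_)
  open import Function.Definitions using (Injective)
  import Relation.Binary.PropositionalEquality as ≡
  open ≡ using (_≡_; _≢_)

  open Incidence using (IncidenceStructure)

  open FiniteField 𝔽 hiding (zero)
  open Geometry 𝔽
  open Vectors 𝔽
  open IntegerCoefficientSolver cring using (solve; _:+_; _:*_; :-_; _:-_; _:=_; con)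
  open import Relation.Binary.Reasoning.Setoid setoid
  open import Algebra.Properties.Group +-group using (x∙y⁻¹≈ε⇒x≈y; x≈y⇒x∙y⁻¹≈ε)

  -- Every point of the projective plane has exactly one representative of one
  -- of the forms (1, a, b), (0, 1, a), (0, 0, 1).
  data NormalForm : Set where
    affine : Fin q → Fin q → NormalForm
    ideal  : Fin q → NormalForm
    ideal∞ : NormalForm

  vector : NormalForm → V
  vector (affine a b) = vec 1# (enum a) (enum b)
  vector (ideal a)    = vec 0# 1# (enum a)
  vector ideal∞       = vec 0# 0# 1#

  N : ℕ
  N = q ℕ.* q ℕ.+ q ℕ.+ 1

  encode : NormalForm → Fin N
  encode (affine a b) = (combine a b ↑ˡ q) ↑ˡ 1
  encode (ideal a)    = ((q ℕ.* q) ↑ʳ a) ↑ˡ 1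
  encode ideal∞       = (q ℕ.* q ℕ.+ q) ↑ʳ zero

  private
    decode-finite : Fin (q ℕ.* q) ⊎ Fin q → NormalForm
    decode-finite (inj₁ k) = affine (proj₁ (remQuot {q} q k)) (proj₂ (remQuot {q} q k))
    decode-finite (inj₂ a) = ideal a

    decode-sum : Fin (q ℕ.* q ℕ.+ q) ⊎ Fin 1 → NormalForm
    decode-sum (inj₁ j) = decode-finite (splitAt (q ℕ.* q) j)
    decode-sum (inj₂ _) = ideal∞

    encode-decode-finite : ∀ t → encode (decode-finite t) ≡ join (q ℕ.* q) q t ↑ˡ 1
    encode-decode-finite (inj₁ k) = ≡.cong (λ j → (j ↑ˡ q) ↑ˡ 1) (Fin.combine-remQuot {q} q k)
    encode-decode-finite (inj₂ a) = ≡.refl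

    encode-decode-sum : ∀ s → encode (decode-sum s) ≡ join (q ℕ.* q ℕ.+ q) 1 s
    encode-decode-sum (inj₁ j) = ≡.trans (encode-decode-finite (splitAt (q ℕ.* q) j))
                                         (≡.cong (_↑ˡ 1) (Fin.join-splitAt (q ℕ.* q) q j))
    encode-decode-sum (inj₂ zero) = ≡.refl

  decode : Fin N → NormalForm
  decode i = decode-sum (splitAt (q ℕ.* q ℕ.+ q) i)

  encode-decode : ∀ i → encode (decode i) ≡ i
  encode-decode i = ≡.trans (encode-decode-sum (splitAt (q ℕ.* q ℕ.+ q) i)) (Fin.join-splitAt (q ℕ.* q ℕ.+ q) 1 i)

  decode-encode : ∀ s → decode (encode s) ≡ s
  decode-encode (affine a b)
    rewrite Fin.splitAt-↑ˡ (q ℕ.* q ℕ.+ q) (combine a b ↑ˡ q) 1 | Fin.splitAt-↑ˡ (q ℕ.* q) (combine a b) q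
    = ≡.cong (λ p → affine (proj₁ p) (proj₂ p)) (Fin.remQuot-combine {q} {q} a b)
  decode-encode (ideal a)
    rewrite Fin.splitAt-↑ˡ (q ℕ.* q ℕ.+ q) ((q ℕ.* q) ↑ʳ a) 1 | Fin.splitAt-↑ʳ (q ℕ.* q) q a = ≡.refl
  decode-encode ideal∞ rewrite Fin.splitAt-↑ʳ (q ℕ.* q ℕ.+ q) 1 zero = ≡.refl

  private
    enum⁻¹ : Carrier → Fin q
    enum⁻¹ x = proj₁ (enum-sur x)

    divide : ∀ {vᵢ} vⱼ r → vᵢ * r ≈ 1# → vⱼ ≈ vᵢ * enum (enum⁻¹ (vⱼ * r))
    divide {vᵢ} vⱼ r vᵢr≈1 = sym (begin
      vᵢ * enum (enum⁻¹ (vⱼ * r))  ≈⟨ *-congˡ (proj₂ (enum-sur (vⱼ * r))) ⟩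
      vᵢ * (vⱼ * r)                ≈⟨ solve 3 (λ a b r → a :* (b :* r) := b :* (a :* r)) refl vᵢ vⱼ r ⟩
      vⱼ * (vᵢ * r)                ≈⟨ *-congˡ vᵢr≈1 ⟩
      vⱼ * 1#                      ≈⟨ *-identityʳ vⱼ ⟩
      vⱼ                           ∎)

    times0 : ∀ {x} a → x ≈ 0# → x ≈ a * 0#
    times0 a x≈0 = trans x≈0 (sym (zeroʳ a))

  normalise : ∀ v → ¬ IsZero v → Σ NormalForm λ s → v ∝ vector s
  normalise v v≉0 with v i₀ ≟ 0# | v i₁ ≟ 0# | v i₂ ≟ 0#
  ... | no v₀≉0 | _ | _ = let (r , v₀r≈1) = inverse _ v₀≉0 in
    affine (enum⁻¹ (v i₁ * r)) (enum⁻¹ (v i₂ * r)) , v i₀ , λ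
    { zero → sym (*-identityʳ _) ; (suc zero) → divide _ r v₀r≈1 ; (suc (suc zero)) → divide _ r v₀r≈1 }
  ... | yes v₀≈0 | no v₁≉0 | _ = let (r , v₁r≈1) = inverse _ v₁≉0 in
    ideal (enum⁻¹ (v i₂ * r)) , v i₁ , λ
    { zero → times0 _ v₀≈0 ; (suc zero) → sym (*-identityʳ _) ; (suc (suc zero)) → divide _ r v₁r≈1 }
  ... | yes v₀≈0 | yes v₁≈0 | no _ = ideal∞ , v i₂ , λ
    { zero → times0 _ v₀≈0 ; (suc zero) → times0 _ v₁≈0 ; (suc (suc zero)) → sym (*-identityʳ _) }
  ... | yes v₀≈0 | yes v₁≈0 | yes v₂≈0 =
    ⊥-elim (v≉0 λ { zero → v₀≈0 ; (suc zero) → v₁≈0 ; (suc (suc zero)) → v₂≈0 })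

  vector-nonzero : ∀ s → ¬ IsZero (vector s)
  vector-nonzero (affine a b) v≈0 = 1≉0 (v≈0 i₀)
  vector-nonzero (ideal a)    v≈0 = 1≉0 (v≈0 i₁)
  vector-nonzero ideal∞       v≈0 = 1≉0 (v≈0 i₂)

  private
    scalar≈1 : ∀ {c} → 1# ≈ c * 1# → ∀ {x y} → x ≈ c * y → x ≈ y
    scalar≈1 {c} 1≈c {x} {y} x≈cy = trans x≈cy (trans (*-congʳ (sym (trans 1≈c (*-identityʳ c)))) (*-identityˡ y))

    scalar≈0 : ∀ {c} → 0# ≈ c * 1# → ∀ y → c * y ≈ 0#
    scalar≈0 {c} 0≈c y = trans (*-congʳ (sym (trans 0≈c (*-identityʳ c)))) (zeroˡ y)

    1≉c*0 : ∀ {c} → ¬ (1# ≈ c * 0#)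
    1≉c*0 {c} 1≈c0 = 1≉0 (trans 1≈c0 (zeroʳ c))

    enum-injective : ∀ {a b} → enum a ≈ enum b → a ≡ b
    enum-injective = enum-inj _ _

  vector-injective : ∀ s t → vector s ∝ vector t → s ≡ t
  vector-injective (affine a b) (affine a′ b′) (_ , e) =
    ≡.cong₂ affine (enum-injective (scalar≈1 (e i₀) (e i₁))) (enum-injective (scalar≈1 (e i₀) (e i₂)))
  vector-injective (affine _ _) (ideal _)    (_ , e) = ⊥-elim (1≉c*0 (e i₀))
  vector-injective (affine _ _) ideal∞       (_ , e) = ⊥-elim (1≉c*0 (e i₀))
  vector-injective (ideal _)    (affine _ _) (_ , e) = ⊥-elim (1≉0 (trans (e i₁) (scalar≈0 (e i₀) _)))
  vector-injective (ideal a)    (ideal a′)   (_ , e) = ≡.cong ideal (enum-injective (scalar≈1 (e i₁) (e i₂)))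
  vector-injective (ideal _)    ideal∞       (_ , e) = ⊥-elim (1≉c*0 (e i₁))
  vector-injective ideal∞       (affine _ _) (_ , e) = ⊥-elim (1≉0 (trans (e i₂) (scalar≈0 (e i₀) _)))
  vector-injective ideal∞       (ideal _)    (_ , e) = ⊥-elim (1≉0 (trans (e i₂) (scalar≈0 (e i₁) _)))
  vector-injective ideal∞       ideal∞       _       = ≡.refl

  point : Fin N → V
  point = vector ∘ decode

  point-nonzero : ∀ i → ¬ IsZero (point i)
  point-nonzero = vector-nonzero ∘ decode

  point-injective : ∀ {i j} → point i ∝ point j → i ≡ j
  point-injective {i} {j} pᵢ∝pⱼ = ≡.trans (≡.sym (encode-decode i))
    (≡.trans (≡.cong encode (vector-injective (decode i) (decode j) pᵢ∝pⱼ)) (encode-decode j))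

  point-of : ∀ v → ¬ IsZero v → Fin N
  point-of v v≉0 = encode (proj₁ (normalise v v≉0))

  ∝-point-of : ∀ v v≉0 → v ∝ point (point-of v v≉0)
  ∝-point-of v v≉0 = ≡.subst (λ s → v ∝ vector s) (≡.sym (decode-encode (proj₁ (normalise v v≉0))))
                                 (proj₂ (normalise v v≉0))

  point-of-∝ : ∀ v v≉0 → point (point-of v v≉0) ∝ v
  point-of-∝ v v≉0 = ∝-sym v≉0 (∝-point-of v v≉0)

  point-of≡⇒∝ : ∀ {v v′} v≉0 v′≉0 → point-of v v≉0 ≡ point-of v′ v′≉0 → v ∝ v′
  point-of≡⇒∝ {v} {v′} v≉0 v′≉0 e =
    ∝-trans (∝-point-of v v≉0) (≡.subst (λ i → point i ∝ v′) (≡.sym e) (point-of-∝ v′ v′≉0))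

  PerpendicularBasis : V → Set
  PerpendicularBasis n = Σ V λ u → Σ V λ w → (dot n u ≈ 0#) × (dot n w ≈ 0#) × Independent u w

  private
    coefficient₁ : ∀ α β → α * 1# + β * 0# ≈ α
    coefficient₁ = solve 2 (λ α β → α :* con (+ 1) :+ β :* con (+ 0) := α) refl

    coefficient₂ : ∀ α β → α * 0# + β * 1# ≈ β
    coefficient₂ = solve 2 (λ α β → α :* con (+ 0) :+ β :* con (+ 1) := β) refl

  perpendicular-basis : ∀ s → PerpendicularBasis (vector s)
  perpendicular-basis (affine a b) = vec (- A) 1# 0# , vec (- B) 0# 1# ,
    solve 2 (λ A B → con (+ 1) :* (:- A) :+ A :* con (+ 1) :+ B :* con (+ 0) := con (+ 0)) refl A B ,
    solve 2 (λ A B → con (+ 1) :* (:- B) :+ A :* con (+ 0) :+ B :* con (+ 1) := con (+ 0)) refl A B ,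
    λ α β ≈0 → trans (sym (coefficient₁ α β)) (≈0 i₁) , trans (sym (coefficient₂ α β)) (≈0 i₂)
    where A = enum a ; B = enum b
  perpendicular-basis (ideal a) = vec 1# 0# 0# , vec 0# (- A) 1# ,
    solve 1 (λ A → con (+ 0) :* con (+ 1) :+ con (+ 1) :* con (+ 0) :+ A :* con (+ 0) := con (+ 0)) refl A ,
    solve 1 (λ A → con (+ 0) :* con (+ 0) :+ con (+ 1) :* (:- A) :+ A :* con (+ 1) := con (+ 0)) refl A ,
    λ α β ≈0 → trans (sym (coefficient₁ α β)) (≈0 i₀) , trans (sym (coefficient₂ α β)) (≈0 i₂)
    where A = enum a
  perpendicular-basis ideal∞ = vec 1# 0# 0# , vec 0# 1# 0# ,
    solve 0 (con (+ 0) :* con (+ 1) :+ con (+ 0) :* con (+ 0) :+ con (+ 1) :* con (+ 0) := con (+ 0)) refl ,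
    solve 0 (con (+ 0) :* con (+ 0) :+ con (+ 0) :* con (+ 1) :+ con (+ 1) :* con (+ 0) := con (+ 0)) refl ,
    λ α β ≈0 → trans (sym (coefficient₁ α β)) (≈0 i₀) , trans (sym (coefficient₂ α β)) (≈0 i₁)

  module Pencil {n u w : V} (nu≈0 : dot n u ≈ 0#) (nw≈0 : dot n w ≈ 0#) (u⊥w : Independent u w) where

    direction : Fin q → V
    direction t i = u i + enum t * w i

    coordinates-unique : ∀ {c a b a′ b′} → (∀ i → a * u i + b * w i ≈ c * (a′ * u i + b′ * w i)) → (a ≈ c * a′) × (b ≈ c * b′)
    coordinates-unique {c} {a} {b} {a′} {b′} e =
      let (a≈ , b≈) = u⊥w (a - c * a′) (b - c * b′) combination≈0 in x∙y⁻¹≈ε⇒x≈y _ _ a≈ , x∙y⁻¹≈ε⇒x≈y _ _ b≈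
      where
      combination≈0 : ∀ i → (a - c * a′) * u i + (b - c * b′) * w i ≈ 0#
      combination≈0 i = trans (solve 7 (λ a b a′ b′ c x y →
          (a :- c :* a′) :* x :+ (b :- c :* b′) :* y := (a :* x :+ b :* y) :- c :* (a′ :* x :+ b′ :* y))
          refl a b a′ b′ c (u i) (w i)) (x≈y⇒x∙y⁻¹≈ε (e i))

    w-coordinates : ∀ i → w i ≈ 0# * u i + 1# * w i
    w-coordinates i = solve 2 (λ x y → y := con (+ 0) :* x :+ con (+ 1) :* y) refl (u i) (w i)

    direction-coordinates : ∀ t i → direction t i ≈ 1# * u i + enum t * w i
    direction-coordinates t i = solve 3 (λ x y z → x :+ z :* y := con (+ 1) :* x :+ z :* y) refl (u i) (w i) (enum t)

    w≉0 : ¬ IsZero w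
    w≉0 w≈0 = 1≉0 (proj₂ (u⊥w 0# 1# λ i → trans (sym (w-coordinates i)) (w≈0 i)))

    direction≉0 : ∀ t → ¬ IsZero (direction t)
    direction≉0 t d≈0 = 1≉0 (proj₁ (u⊥w 1# (enum t) λ i → trans (sym (direction-coordinates t i)) (d≈0 i)))

    members : Fin (ℕ.suc q) → Fin N
    members zero    = point-of w w≉0
    members (suc t) = point-of (direction t) (direction≉0 t)

    perpendicular : ∀ t → dot n (point (members t)) ≈ 0#
    perpendicular zero    = dot-∝ʳ n (point-of-∝ w w≉0) nw≈0
    perpendicular (suc t) = dot-∝ʳ n (point-of-∝ (direction t) (direction≉0 t)) (begin
      dot n (direction t)           ≈⟨ solve 10 (λ n₀ n₁ n₂ u₀ u₁ u₂ w₀ w₁ w₂ t →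
           n₀ :* (u₀ :+ t :* w₀) :+ n₁ :* (u₁ :+ t :* w₁) :+ n₂ :* (u₂ :+ t :* w₂)
           := (n₀ :* u₀ :+ n₁ :* u₁ :+ n₂ :* u₂) :+ t :* (n₀ :* w₀ :+ n₁ :* w₁ :+ n₂ :* w₂)) refl
           (n i₀) (n i₁) (n i₂) (u i₀) (u i₁) (u i₂) (w i₀) (w i₁) (w i₂) (enum t) ⟩
      dot n u + enum t * dot n w    ≈⟨ +-cong nu≈0 (*-congˡ nw≈0) ⟩
      0# + enum t * 0#              ≈⟨ trans (+-identityˡ _) (zeroʳ _) ⟩
      0#                            ∎)

    members-injective : ∀ {t t′} → members t ≡ members t′ → t ≡ t′
    members-injective {zero} {zero} _ = ≡.refl
    members-injective {zero} {suc t} e =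
      let (c , w≈cd) = point-of≡⇒∝ w≉0 (direction≉0 t) e
          (0≈c , 1≈ct) = coordinates-unique (λ i → trans (sym (w-coordinates i)) (trans (w≈cd i) (*-congˡ (direction-coordinates t i))))
      in ⊥-elim (1≉0 (trans 1≈ct (trans (*-congʳ (trans (sym (*-identityʳ c)) (sym 0≈c))) (zeroˡ _))))
    members-injective {suc t} {zero} e =
      let (c , d≈cw) = point-of≡⇒∝ (direction≉0 t) w≉0 e
      in ⊥-elim (1≉c*0 (proj₁ (coordinates-unique (λ i → trans (sym (direction-coordinates t i)) (trans (d≈cw i) (*-congˡ (w-coordinates i)))))))
    members-injective {suc t} {suc t′} e =
      let (c , d≈cd′) = point-of≡⇒∝ (direction≉0 t) (direction≉0 t′) e
          (1≈c , t≈ct′) = coordinates-unique (λ i → trans (sym (direction-coordinates t i))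
                                                 (trans (d≈cd′ i) (*-congˡ (direction-coordinates t′ i))))
      in ≡.cong suc (enum-injective (scalar≈1 1≈c t≈ct′))

  -- A point p lies on the plane with normal π.
  _I_ : Fin N → Fin N → Set
  p I π = dot (point π) (point p) ≈ 0#

  points-on : ∀ π → Σ (Fin (ℕ.suc q) → Fin N) λ h → Injective ≡._≡_ ≡._≡_ h × (∀ t → h t I π)
  points-on π with perpendicular-basis (decode π)
  ... | u , w , nu≈0 , nw≈0 , u⊥w = members , members-injective , perpendicular
    where open Pencil {point π} {u} {w} nu≈0 nw≈0 u⊥w

  lines-through : ∀ p → Σ (Fin (ℕ.suc q) → Fin N) λ h → Injective ≡._≡_ ≡._≡_ h × (∀ t → p I h t)
  lines-through p with points-on p
  ... | h , h-injective , h-on = h , h-injective , λ t → trans (dot-comm (point (h t)) (point p)) (h-on t)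

  one-common-line : ∀ {p p′ π π′} → p ≢ p′ → π ≢ π′ → p I π → p′ I π → p I π′ → p′ I π′ → ⊥
  one-common-line {p} {p′} {π} {π′} p≢p′ π≢π′ =
    two-points-two-normals {point p} {point p′} {point π} {point π′}
      (point-nonzero p′) (p≢p′ ∘ point-injective) (point-nonzero π′) (π≢π′ ∘ point-injective)

  projective-plane : IncidenceStructure q N N
  projective-plane = record
    { _I_ = _I_ ; points-on = points-on ; blocks-through = lines-through ; one-common-block = one-common-line }

module Subspaces {q : ℕ} (𝔽 : FiniteField q) where

  open import Data.Nat as ℕ using (ℕ)
  open import Data.Fin using (Fin; zero; suc)
  open import Data.List using (length; lookup)
  open import Data.Vec.Functional using (_∷_)
  open import Data.Product using (∃; _×_; _,_)
  open import Data.Empty using (⊥-elim)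
  open import Function using (_∘_)
  open import Function.Definitions using (Injective)
  open import Relation.Nullary using (¬_)
  open import Relation.Nullary.Decidable using (decidable-stable)
  open import Relation.Binary.PropositionalEquality

  open Enumerations
  open Enumeration
  open Geometry 𝔽
  open Vectors 𝔽
  open ProjectivePlane 𝔽

  -- A line is coded by its point, a plane by its normal vector.
  code : Sub → Fin N
  code (line v v≉0)    = point-of v v≉0
  code (plane u w u⊥w) = point-of (cross u w) (independent⇒cross≉0 u⊥w)

  private
    plane⊆plane : ∀ {u w u′ w′} u⊥w u′⊥w′ → cross u′ w′ ∝ cross u w → plane u w u⊥w ⊆ plane u′ w′ u′⊥w′
    plane⊆plane _ u′⊥w′ n′∝n x x∈uw = dot-cross≈0⇒span u′⊥w′ (dot-∝ˡ x n′∝n (span⇒dot-cross≈0 x∈uw))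

  code-injective : ∀ S T → dim S ≡ dim T → code S ≡ code T → S ≐ T
  code-injective (line v v≉0) (line v′ v′≉0) _ e =
    (λ x x∝v → ∝-trans x∝v (point-of≡⇒∝ v≉0 v′≉0 e)) , (λ x x∝v′ → ∝-trans x∝v′ (point-of≡⇒∝ v′≉0 v≉0 (sym e)))
  code-injective (plane u w u⊥w) (plane u′ w′ u′⊥w′) _ e =
    plane⊆plane {u} {w} {u′} {w′} u⊥w u′⊥w′ (point-of≡⇒∝ n′≉0 n≉0 (sym e)) ,
    plane⊆plane {u′} {w′} {u} {w} u′⊥w′ u⊥w (point-of≡⇒∝ n≉0 n′≉0 e)
    where
    n≉0 : ¬ IsZero (cross u w)
    n≉0 = independent⇒cross≉0 u⊥w
    n′≉0 : ¬ IsZero (cross u′ w′)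
    n′≉0 = independent⇒cross≉0 u′⊥w′
  code-injective (line _ _)    (plane _ _ _) ()
  code-injective (plane _ _ _) (line _ _)    ()

  line⊆plane : ∀ {v v≉0 u w u⊥w} → code (line v v≉0) I code (plane u w u⊥w) → line v v≉0 ⊆ plane u w u⊥w
  line⊆plane {v} {v≉0} {u} {w} {u⊥w} incident x x∝v =
    dot-cross≈0⇒span u⊥w (dot-∝ʳ (cross u w) x∝v
      (dot-∝ˡ v (∝-point-of (cross u w) (independent⇒cross≉0 u⊥w))
                  (dot-∝ʳ (point (code (plane u w u⊥w))) (∝-point-of v v≉0) incident)))

  plane-dim : ∀ S → ¬ dim S ≡ 1 → dim S ≡ 2
  plane-dim (line _ _)    ¬dim≡1 = ⊥-elim (¬dim≡1 refl)
  plane-dim (plane _ _ _) _      = refl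

  incident⇒⊆ : ∀ S T → dim S ≡ 1 → ¬ dim T ≡ 1 → code S I code T → S ⊆ T
  incident⇒⊆ (line v v≉0) (plane u w u⊥w) _ _ = line⊆plane {v} {v≉0} {u} {w} {u⊥w}
  incident⇒⊆ (line _ _)    (line _ _)    _ ¬dim≡1 = ⊥-elim (¬dim≡1 refl)
  incident⇒⊆ (plane _ _ _) _             ()

  module Classify (ℱ : Family) (no-duplicates : NoDup ℱ) where

    F : Fin (length ℱ) → Sub
    F = lookup ℱ

    open Partition (partition (λ i → dim (F i) ℕ.≟ 1)) public
      renaming (inside to lines; outside to planes; sizes to lines+planes≡|ℱ|)

    a : Fin (size lines) → Fin N
    a = code ∘ F ∘ element lines

    β : Fin (size planes) → Fin N
    β = code ∘ F ∘ element planes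

    a-injective : Injective _≡_ _≡_ a
    a-injective e = injective lines (no-duplicates _ _
      (code-injective _ _ (trans (sound lines _) (sym (sound lines _))) e))

    β-injective : Injective _≡_ _≡_ β
    β-injective e = injective planes (no-duplicates _ _
      (code-injective _ _ (trans (plane-dim _ (sound planes _)) (sym (plane-dim _ (sound planes _)))) e))

    line≢plane : ∀ r r′ → element lines r ≢ element planes r′
    line≢plane r r′ e = sound planes r′ (subst (λ i → dim (F i) ≡ 1) e (sound lines r))

    private
      cone-injective : ∀ {k} {x : Fin (length ℱ)} {ys : Fin k → Fin (length ℱ)} →
                       Injective _≡_ _≡_ ys → (∀ s → x ≢ ys s) → ∀ i j → (x ∷ ys) i ≡ (x ∷ ys) j → i ≡ j
      cone-injective ys-injective x∉ys zero    zero    _ = refl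
      cone-injective ys-injective x∉ys zero    (suc s) e = ⊥-elim (x∉ys s e)
      cone-injective ys-injective x∉ys (suc s) zero    e = ⊥-elim (x∉ys s (sym e))
      cone-injective ys-injective x∉ys (suc s) (suc t) e = cong suc (ys-injective e)

    V-free : ∀ {k} → ¬ ContainsV k ℱ → ∀ i (ψ : Fin k → Fin (size planes)) → Injective _≡_ _≡_ ψ →
             ¬ (∀ s → a i I β (ψ s))
    V-free ¬V i ψ ψ-injective incident = ¬V (element lines i ∷ element planes ∘ ψ ,
      cone-injective (ψ-injective ∘ injective planes) (λ s → line≢plane i (ψ s)) ,
      λ s → incident⇒⊆ (F (element lines i)) (F (element planes (ψ s))) (sound lines i) (sound planes (ψ s)) (incident s))

    Λ-free : ∀ {l} → ¬ ContainsΛ l ℱ → ∀ j (ψ : Fin l → Fin (size lines)) → Injective _≡_ _≡_ ψ →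
             ¬ (∀ s → a (ψ s) I β j)
    Λ-free ¬Λ j ψ ψ-injective incident = ¬Λ (element planes j ∷ element lines ∘ ψ ,
      cone-injective (ψ-injective ∘ injective lines) (λ s → line≢plane (ψ s) j ∘ sym) ,
      λ s → incident⇒⊆ (F (element lines (ψ s))) (F (element planes j)) (sound lines (ψ s)) (sound planes j) (incident s))

    all-lines : size planes ≡ 0 → (∀ p → ∃ λ r → a r ≡ p) → AllOfDim 1 ℱ
    all-lines no-planes a-surjective = (λ i → decidable-stable (dim (F i) ℕ.≟ 1) (size≡0⇒empty planes no-planes)) , covers
      where
      covers : ∀ S → dim S ≡ 1 → ∃ λ i → F i ≐ S
      covers S dim≡1 = let (r , e) = a-surjective (code S) in
        element lines r , code-injective _ S (trans (sound lines r) (sym dim≡1)) e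

    all-planes : size lines ≡ 0 → (∀ π → ∃ λ r → β r ≡ π) → AllOfDim 2 ℱ
    all-planes no-lines β-surjective = (λ i → plane-dim (F i) (size≡0⇒empty lines no-lines)) , covers
      where
      covers : ∀ S → dim S ≡ 2 → ∃ λ i → F i ≐ S
      covers S dim≡2 = let (r , e) = β-surjective (code S) in
        element planes r , code-injective _ S (trans (plane-dim _ (sound planes r)) (sym dim≡2)) e

open import Data.Nat using (ℕ; _≤_; _+_; _*_)
open import Data.Product using (_×_)
open import Data.Sum using (_⊎_)
open import Data.List using (length)
open import Relation.Nullary using (¬_)
open import Relation.Binary.PropositionalEquality using (_≡_)

open import Data.Product using (_,_; uncurry)
import Data.Sum as Sum
open import Relation.Binary.PropositionalEquality using (subst; trans)
open Incidence using (module ChainFreeFamily)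

lemma5 : (q : ℕ) (𝔽 : FiniteField q) (k l : ℕ) → 1 ≤ k → 1 ≤ l →
         BoundOK q k → BoundOK q l →
         (ℱ : Geometry.Family 𝔽) → Geometry.NoDup 𝔽 ℱ →
         ¬ Geometry.ContainsV 𝔽 k ℱ → ¬ Geometry.ContainsΛ 𝔽 l ℱ →
         (length ℱ ≤ q * q + q + 1) ×
         (length ℱ ≡ q * q + q + 1 →
           Geometry.AllOfDim 𝔽 1 ℱ ⊎ Geometry.AllOfDim 𝔽 2 ℱ)
lemma5 q 𝔽 k l _ _ (k≤q , q²≤2[q∸k]²) (l≤q , q²≤2[q∸l]²) ℱ no-duplicates ¬V ¬Λ =
  subst (_≤ q * q + q + 1) lines+planes≡|ℱ| size-bound ,
  λ |ℱ|≡N → Sum.map (uncurry all-lines) (uncurry all-planes) (extremal (trans lines+planes≡|ℱ| |ℱ|≡N))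
  where
  open Subspaces.Classify 𝔽 ℱ no-duplicates
  open ChainFreeFamily (ProjectivePlane.projective-plane 𝔽) k l k≤q l≤q q²≤2[q∸k]² q²≤2[q∸l]²
         a a-injective β β-injective (V-free ¬V) (Λ-free ¬Λ)
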